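{- Let $T$ be a tree with maximum degree $\Delta(T)$, and let $k$ be an integer with $\zeta(T)\le k<\Delta(T)$. Then $\mathrm{capt}_{\zeta,k}(T)\ge\left\lceil\frac{\Delta(T)-1}{k}\right\rceil$.
   Context: The localization game on a connected graph $G$ with $k$ cops: the robber, invisible to the cops, first chooses a starting vertex. In each round the cops choose a multiset of vertices $u_1,\dots,u_k$ (no adjacency restriction) and learn the distances $d(u_i,R)$ to the robber's current vertex $R$; the cops capture the robber if, from all information so far, they can determine the robber's vertex uniquely. If not captured, the robber moves to a neighbor or stays. The robber is omniscient. The localization number $\zeta(G)$ is the least number of cops guaranteeing capture in finitely many rounds. For $k\ge\zeta(G)$, $\mathrm{capt}_{\zeta,k}(G)$ is the minimum number of rounds in which $k$ cops can guarantee capture under optimal play (it is only defined for $k\ge\zeta(G)$). -}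

module Defs where

open import Data.Nat using (ℕ; zero; suc; _+_; _≤_; _<_; _⊔_)
open import Data.Nat.DivMod using (_/_)
open import Data.Bool using (Bool; true; false; T; if_then_else_; _∨_; _∧_)
open import Data.Fin using (Fin; _≟_)
open import Data.List using (List; []; _∷_; _++_; length; allFin; filter; map; foldr)
open import Data.Bool.ListAction using (any)
open import Data.List.Relation.Unary.Linked using (Linked)
open import Data.List.Relation.Unary.Unique.Propositional using (Unique)
open import Data.Vec as Vec using (Vec)
open import Data.Product using (Σ; ∃; _×_)
open import Data.Sum using (_⊎_)
open import Relation.Nullary using (¬_; ⌊_⌋)
open import Relation.Binary.PropositionalEquality using (_≡_)

record Graph (n : ℕ) : Set where
  field
    adj    : Fin n → Fin n → Bool
    sym    : ∀ u v → adj u v ≡ adj v u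
    irrefl : ∀ u → adj u u ≡ false

module _ {n : ℕ} (G : Graph n) where
  open Graph G

  E : Fin n → Fin n → Set
  E u v = T (adj u v)

  Connected : Set
  Connected = ∀ u v → Σ (List (Fin n)) λ ws → Linked E (u ∷ ws ++ v ∷ [])

  IsCycle : Fin n → List (Fin n) → Set
  IsCycle x ys = (2 ≤ length ys) × Unique (x ∷ ys) × Linked E (x ∷ ys ++ x ∷ [])

  Acyclic : Set
  Acyclic = ∀ x ys → ¬ IsCycle x ys

  IsTree : Set
  IsTree = Connected × Acyclic

  deg : Fin n → ℕ
  deg v = length (filter (λ w → T? (adj v w)) (allFin n))
    where
      open import Relation.Nullary.Decidable using (Dec; yes; no)
      T? : (b : Bool) → Dec (T b)
      T? true  = yes _
      T? false = no λ ()

  maxDeg : ℕ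
  maxDeg = foldr _⊔_ 0 (map deg (allFin n))

  reach : ℕ → Fin n → Fin n → Bool
  reach zero    u v = ⌊ u ≟ v ⌋
  reach (suc r) u v = reach r u v ∨ any (λ w → adj u w ∧ reach r w v) (allFin n)

  -- graph distance: least r with reach r u v (searching r = 0,…,n;
  -- in a connected graph the distance is < n, so the search succeeds)
  distFrom : ℕ → ℕ → Fin n → Fin n → ℕ
  distFrom zero     r u v = r
  distFrom (suc f)  r u v = if reach r u v then r else distFrom f (suc r) u v

  dist : Fin n → Fin n → ℕ
  dist = distFrom n 0

  -- a cop strategy: given the list of all previous responses (most
  -- recent first), choose the k probe vertices of the current round
  Strategy : ℕ → Set
  Strategy k = List (Vec ℕ k) → Vec (Fin n) k

  IsRobberWalk : (ℕ → Fin n) → Set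
  IsRobberWalk w = ∀ i → (w (suc i) ≡ w i) ⊎ E (w i) (w (suc i))

  -- history i = responses of rounds 0,…,i-1 (most recent first)
  history : ∀ {k} → Strategy k → (ℕ → Fin n) → ℕ → List (Vec ℕ k)
  history σ w zero    = []
  history σ w (suc i) =
    Vec.map (λ u → dist u (w i)) (σ (history σ w i)) ∷ history σ w i

  CapturedAt : ∀ {k} → Strategy k → (ℕ → Fin n) → ℕ → Set
  CapturedAt σ w i = ∀ w′ → IsRobberWalk w′ →
    history σ w′ (suc i) ≡ history σ w (suc i) → w′ i ≡ w i

  WinsWithin : ∀ {k} → Strategy k → ℕ → Set
  WinsWithin σ t = ∀ w → IsRobberWalk w → Σ ℕ λ i → (i < t) × CapturedAt σ w i

  -- ζ(G) ≤ k : k cops have a strategy capturing the robber in finitely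
  -- many rounds
  ZetaAtMost : ℕ → Set
  ZetaAtMost k = Σ (Strategy k) λ σ → Σ ℕ λ t → WinsWithin σ t

  -- capt_{ζ,k}(G) ≥ m : no k-cop strategy guarantees capture in fewer
  -- than m rounds
  CaptAtLeast : ℕ → ℕ → Set
  CaptAtLeast k m = ∀ (σ : Strategy k) t → WinsWithin σ t → m ≤ t

-- ceiling division ⌈a / k⌉ (for k ≥ 1; value 0 for k = 0, unused)
ceilDiv : ℕ → ℕ → ℕ
ceilDiv a zero    = 0
ceilDiv a (suc k) = (a + k) / suc k

module Submission where

-- Let v be a vertex of maximum degree Δ and let the robber sit still on a
-- neighbour of v.  A probe at u cannot tell apart the neighbours of v outside
-- the branch at v containing u: in a tree they are all at distance d(u, v) + 1
-- from u.  So each probe rules out at most one of the Δ candidates, and after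
-- t rounds at least Δ - tk remain indistinguishable; capture forces Δ - tk ≤ 1.

open import Defs
open import Data.Bool using (Bool; true; false; T; if_then_else_)
open import Data.Bool.Properties using (T-∨; T-∧)
open import Data.Empty using (⊥-elim)
open import Data.Fin using (Fin; _≟_)
open import Data.List using (List; []; _∷_; _++_; length; allFin; filter; map; foldr)
open import Data.List.Membership.Propositional using (_∈_; lose)
open import Data.List.Membership.Propositional.Properties using (∈-allFin; ∈-filter⁻)
open import Data.List.Properties using (∷-injectiveʳ; filter-all)
open import Data.List.Relation.Unary.All as All using (All; []; _∷_)
open import Data.List.Relation.Unary.All.Properties using (all-filter; ¬Any⇒All¬)
import Data.List.Relation.Unary.All.Properties as All
open import Data.List.Relation.Unary.AllPairs using ([]; _∷_)
open import Data.List.Relation.Unary.Any using (here; there; satisfied)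
open import Data.List.Relation.Unary.Any.Properties using (any⁺; any⁻)
open import Data.List.Relation.Unary.Linked using (Linked; [-]; _∷_)
open import Data.List.Relation.Unary.Unique.Propositional using (Unique)
import Data.List.Relation.Unary.Unique.Propositional.Properties as Unique
open import Data.Nat
  using (ℕ; zero; suc; _+_; _*_; _∸_; _≤_; _<_; _≤′_; ≤′-refl; ≤′-step; _⊔_; z≤n; s≤s)
open import Data.Nat.DivMod using (m<n*o⇒m/o<n)
open import Data.Nat.Properties
  using (≤-refl; ≤-trans; ≤-reflexive; ≤-pred; ≤⇒≤′; m≤m+n; n≤1+n; +-comm; +-assoc; +-suc;
         +-monoˡ-≤; +-identityʳ; ⊔-sel; ∸-monoˡ-≤; m+n∸n≡m)
import Data.Nat.Properties as ℕ
open import Data.Product using (Σ; ∃; ∃₂; _×_; _,_)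
open import Data.Sum using (_⊎_; inj₁; inj₂)
open import Data.Vec as Vec using (Vec)
open import Function.Bundles using (Equivalence)
open import Relation.Nullary using (¬_; Dec; yes; no)
open import Relation.Nullary.Decidable using (toWitness; fromWitness; decidable-stable)
open import Relation.Binary.PropositionalEquality using (_≡_; _≢_; refl; sym; trans; cong; cong₂; subst)

T-injective : ∀ {a b} → (T a → T b) → (T b → T a) → a ≡ b
T-injective {false} {false} _ _ = refl
T-injective {false} {true}  _ f = ⊥-elim (f _)
T-injective {true}  {false} f _ = ⊥-elim (f _)
T-injective {true}  {true}  _ _ = refl

search : (ℕ → Bool) → ℕ → ℕ → ℕ
search g zero    r = r
search g (suc f) r = if g r then r else search g f (suc r)

search-cong : ∀ {g h} → (∀ r → g r ≡ h r) → ∀ f r → search g f r ≡ search h f r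
search-cong g≗h zero    r = refl
search-cong {g} {h} g≗h (suc f) r rewrite g≗h r =
  cong (if h r then r else_) (search-cong g≗h f (suc r))

length≤length-filter+1 : ∀ {A : Set} {P : A → Set} (P? : ∀ x → Dec (P x)) {xs : List A} →
  Unique xs → (∀ {y z} → y ∈ xs → z ∈ xs → ¬ P y → ¬ P z → y ≡ z) →
  length xs ≤ length (filter P? xs) + 1
length≤length-filter+1 P? {[]}     _            _       = z≤n
length≤length-filter+1 P? {x ∷ xs} (x∉xs ∷ uxs) one-off with P? x
... | yes _  = s≤s (length≤length-filter+1 P? uxs λ y∈ z∈ → one-off (there y∈) (there z∈))
... | no ¬px = ≤-reflexive (trans (+-comm 1 (length xs))
                                  (cong (λ ys → length ys + 1) (sym (filter-all P? rest))))
  where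
    rest : All _ xs
    rest = All.tabulate λ {z} z∈ → decidable-stable (P? z) λ ¬pz →
      All.lookup x∉xs z∈ (one-off (here refl) (there z∈) ¬px ¬pz)

module _ {n : ℕ} (G : Graph n) where

  E-sym : ∀ {a b} → E G a b → E G b a
  E-sym {a} {b} = subst T (Graph.sym G a b)

  E-irrefl : ∀ {a} → ¬ E G a a
  E-irrefl {a} = subst T (Graph.irrefl G a)

  reach-zero⁻ : ∀ {a b} → T (reach G 0 a b) → a ≡ b
  reach-zero⁻ = toWitness

  reach-suc⁻ : ∀ {r a b} → T (reach G (suc r) a b) →
               T (reach G r a b) ⊎ ∃ λ w → E G a w × T (reach G r w b)
  reach-suc⁻ t with Equivalence.to T-∨ t
  ... | inj₁ p = inj₁ p
  ... | inj₂ p with satisfied (any⁻ _ (allFin n) p)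
  ... | w , q = inj₂ (w , Equivalence.to T-∧ q)

  reach-stay : ∀ {r a b} → T (reach G r a b) → T (reach G (suc r) a b)
  reach-stay t = Equivalence.from T-∨ (inj₁ t)

  reach-step : ∀ {r a w b} → E G a w → T (reach G r w b) → T (reach G (suc r) a b)
  reach-step {w = w} e t =
    Equivalence.from T-∨ (inj₂ (any⁺ _ (lose (∈-allFin w) (Equivalence.from T-∧ (e , t)))))

  reach-refl : ∀ r {a} → T (reach G r a a)
  reach-refl zero    = fromWitness refl
  reach-refl (suc r) = reach-stay {r} (reach-refl r)

  reach-mono : ∀ {r s a b} → r ≤ s → T (reach G r a b) → T (reach G s a b)
  reach-mono {s = s} z≤n t rewrite reach-zero⁻ t = reach-refl s
  reach-mono {suc r} {suc s} {b = b} (s≤s r≤s) t with reach-suc⁻ {r} t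
  ... | inj₁ p           = reach-stay {s} (reach-mono r≤s p)
  ... | inj₂ (w , e , p) = reach-step {s} e (reach-mono {r} {s} {w} {b} r≤s p)

  reach-snoc : ∀ {r a b c} → T (reach G r a b) → E G b c → T (reach G (suc r) a c)
  reach-snoc {zero} t e rewrite reach-zero⁻ t = reach-step {0} e (reach-refl 0)
  reach-snoc {suc r} t e with reach-suc⁻ {r} t
  ... | inj₁ p            = reach-stay {suc r} (reach-snoc {r} p e)
  ... | inj₂ (w , e′ , p) = reach-step {suc r} e′ (reach-snoc {r} {w} p e)

  history-prefix : ∀ {k} (σ : Strategy G k) {w w′ m t} → m ≤′ t →
                   history G σ w t ≡ history G σ w′ t → history G σ w m ≡ history G σ w′ m
  history-prefix σ ≤′-refl          same = same
  history-prefix σ (≤′-step m≤′t) same = history-prefix σ m≤′t (∷-injectiveʳ same)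

  indistinguishable⇒¬WinsWithin : ∀ {k} (σ : Strategy G k) {w w′ t} →
    IsRobberWalk G w → IsRobberWalk G w′ → (∀ i → w i ≢ w′ i) →
    history G σ w t ≡ history G σ w′ t → ¬ WinsWithin G σ t
  indistinguishable⇒¬WinsWithin σ walk walk′ apart same wins with wins _ walk
  ... | i , i<t , captured =
    apart i (sym (captured _ walk′ (history-prefix σ (≤⇒≤′ i<t) (sym same))))

  EquidistantButOne : (Fin n → Set) → (Fin n → ℕ) → Set
  EquidistantButOne P f = ∀ u {y z} → P y → P z → dist G u y ≢ f u → dist G u z ≢ f u → y ≡ z

  module StationaryRobbers {k} (σ : Strategy G k) {P : Fin n → Set} {f : Fin n → ℕ}
                   (equidistant : EquidistantButOne P f) where

    stay : Fin n → ℕ → Fin n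
    stay z _ = z

    refine : ∀ {m} → Vec (Fin n) m → List (Fin n) → List (Fin n)
    refine Vec.[]       S = S
    refine (u Vec.∷ π) S = filter (λ z → dist G u z ℕ.≟ f u) (refine π S)

    refine-unique : ∀ {m} (π : Vec (Fin n) m) {S} → Unique S → Unique (refine π S)
    refine-unique Vec.[]       uS = uS
    refine-unique (u Vec.∷ π) uS = Unique.filter⁺ _ (refine-unique π uS)

    refine-all : ∀ {m} (π : Vec (Fin n) m) {S} → All P S → All P (refine π S)
    refine-all Vec.[]       aS = aS
    refine-all (u Vec.∷ π) aS = All.filter⁺ _ (refine-all π aS)

    refine-length : ∀ {m} (π : Vec (Fin n) m) {S} → Unique S → All P S →
                    length S ≤ length (refine π S) + m
    refine-length Vec.[] uS aS = ≤-reflexive (sym (+-identityʳ _))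
    refine-length {suc m} (u Vec.∷ π) {S} uS aS = begin
      length S                                  ≤⟨ refine-length π uS aS ⟩
      length (refine π S) + m                   ≤⟨ +-monoˡ-≤ m (length≤length-filter+1 _ unique one-off) ⟩
      length (refine (u Vec.∷ π) S) + 1 + m     ≡⟨ +-assoc (length (refine (u Vec.∷ π) S)) 1 m ⟩
      length (refine (u Vec.∷ π) S) + suc m     ∎
      where
        open ℕ.≤-Reasoning
        unique = refine-unique π uS
        all-P  = refine-all π aS
        one-off : ∀ {y z} → y ∈ refine π S → z ∈ refine π S →
                  dist G u y ≢ f u → dist G u z ≢ f u → y ≡ z
        one-off y∈ z∈ = equidistant u (All.lookup all-P y∈) (All.lookup all-P z∈)

    refine-∈ : ∀ {m} (π : Vec (Fin n) m) {S z} → z ∈ refine π S →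
               z ∈ S × Vec.map (λ u → dist G u z) π ≡ Vec.map f π
    refine-∈ Vec.[]       z∈ = z∈ , refl
    refine-∈ (u Vec.∷ π) z∈ with ∈-filter⁻ _ z∈
    ... | z∈′ , dist≡ with refine-∈ π z∈′
    ...   | z∈S , dists≡ = z∈S , cong₂ Vec._∷_ dist≡ dists≡

    record Survivors (S₀ : List (Fin n)) (t : ℕ) : Set where
      field
        alive      : List (Fin n)
        heard      : List (Vec ℕ k)
        unique     : Unique alive
        candidates : All P alive
        many       : length S₀ ≤ length alive + t * k
        agree      : ∀ {z} → z ∈ alive → history G σ (stay z) t ≡ heard

    survivors : ∀ {S₀} → Unique S₀ → All P S₀ → ∀ t → Survivors S₀ t
    survivors {S₀} uS₀ aS₀ zero = record
      { alive = S₀ ; heard = [] ; unique = uS₀ ; candidates = aS₀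
      ; many = m≤m+n (length S₀) 0 ; agree = λ _ → refl }
    survivors {S₀} uS₀ aS₀ (suc t) = record
      { alive = refine π alive ; heard = Vec.map f π ∷ heard
      ; unique = refine-unique π unique ; candidates = refine-all π candidates
      ; many = begin
          length S₀                                 ≤⟨ many ⟩
          length alive + t * k                      ≤⟨ +-monoˡ-≤ (t * k) (refine-length π unique candidates) ⟩
          length (refine π alive) + k + t * k       ≡⟨ +-assoc (length (refine π alive)) k (t * k) ⟩
          length (refine π alive) + suc t * k       ∎
      ; agree = agree′ }
      where
        open Survivors (survivors uS₀ aS₀ t)
        open ℕ.≤-Reasoning
        π = σ heard
        agree′ : ∀ {z} → z ∈ refine π alive → history G σ (stay z) (suc t) ≡ Vec.map f π ∷ heard
        agree′ z∈ with refine-∈ π z∈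
        ... | z∈alive , dists≡ rewrite agree z∈alive = cong (_∷ heard) dists≡

    capture-bound : ∀ {S₀} → Unique S₀ → All P S₀ → ∀ t → WinsWithin G σ t →
                    length S₀ ≤ t * k + 1
    capture-bound {S₀} uS₀ aS₀ t wins = begin
      length S₀             ≤⟨ many ⟩
      length alive + t * k  ≤⟨ +-monoˡ-≤ (t * k) (at-most-one alive unique agree) ⟩
      1 + t * k             ≡⟨ +-comm 1 (t * k) ⟩
      t * k + 1             ∎
      where
        open Survivors (survivors uS₀ aS₀ t)
        open ℕ.≤-Reasoning
        at-most-one : ∀ S {H} → Unique S → (∀ {z} → z ∈ S → history G σ (stay z) t ≡ H) →
                      length S ≤ 1
        at-most-one []            _                 _    = z≤n
        at-most-one (_ ∷ [])      _                 _    = ≤-refl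
        at-most-one (y ∷ z ∷ _) ((y≢z ∷ _) ∷ _) same =
          ⊥-elim (indistinguishable⇒¬WinsWithin σ (λ _ → inj₁ refl) (λ _ → inj₁ refl) (λ _ → y≢z)
                    (trans (same (here refl)) (sym (same (there (here refl))))) wins)

module Avoiding {n : ℕ} (G : Graph n) (c : Fin n) where
  open import Data.List.Membership.DecPropositional (_≟_ {n}) using (_∈?_)

  data Walk : Fin n → Fin n → Set where
    stop : ∀ {a} → a ≢ c → Walk a a
    step : ∀ {a w b} → a ≢ c → E G a w → Walk w b → Walk a b

  vertices : ∀ {a b} → Walk a b → List (Fin n)
  vertices (stop {a} _)     = a ∷ []
  vertices (step {a} _ _ p) = a ∷ vertices p

  snoc : ∀ {a b d} → Walk a b → d ≢ c → E G b d → Walk a d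
  snoc (stop a≢c)       d≢c e′ = step a≢c e′ (stop d≢c)
  snoc (step a≢c e p)   d≢c e′ = step a≢c e (snoc p d≢c e′)

  reverse : ∀ {a b} → Walk a b → Walk b a
  reverse (stop a≢c)     = stop a≢c
  reverse (step a≢c e p) = snoc (reverse p) a≢c (E-sym G e)

  _++ʷ_ : ∀ {a b d} → Walk a b → Walk b d → Walk a d
  stop _       ++ʷ q = q
  step a≢c e p ++ʷ q = step a≢c e (p ++ʷ q)

  suffix : ∀ {a w b} (p : Walk w b) → Unique (vertices p) → a ∈ vertices p →
           Σ (Walk a b) λ q → Unique (vertices q)
  suffix (stop a≢c)     u       (here refl) = stop a≢c , u
  suffix (step a≢c e p) u       (here refl) = step a≢c e p , u
  suffix (step _ _ p)   (_ ∷ u) (there a∈p) = suffix p u a∈p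

  simplify : ∀ {a b} → Walk a b → Σ (Walk a b) λ q → Unique (vertices q)
  simplify (stop a≢c) = stop a≢c , [] ∷ []
  simplify (step {a} a≢c e p) with simplify p
  ... | q , uq with a ∈? vertices q
  ... | yes a∈q = suffix q uq a∈q
  ... | no  a∉q = step a≢c e q , ¬Any⇒All¬ (vertices q) a∉q ∷ uq

  c∉vertices : ∀ {a b} (p : Walk a b) → All (c ≢_) (vertices p)
  c∉vertices (stop a≢c)     = (λ c≡a → a≢c (sym c≡a)) ∷ []
  c∉vertices (step a≢c _ p) = (λ c≡a → a≢c (sym c≡a)) ∷ c∉vertices p

  closed-linked : ∀ {a b d d′} (p : Walk a b) → E G d a → E G b d′ →
                  Linked (E G) (d ∷ vertices p ++ d′ ∷ [])
  closed-linked (stop _)     e e′ = e ∷ e′ ∷ [-]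
  closed-linked (step _ e p) e″ e′ = e″ ∷ closed-linked p e e′

  2≤length-vertices : ∀ {a b} (p : Walk a b) → a ≢ b → 2 ≤ length (vertices p)
  2≤length-vertices (stop _)              a≢a = ⊥-elim (a≢a refl)
  2≤length-vertices (step _ _ (stop _))   _   = s≤s (s≤s z≤n)
  2≤length-vertices (step _ _ (step _ _ _)) _ = s≤s (s≤s z≤n)

  branch-unique : Acyclic G → ∀ {u y z} → E G c y → E G c z → Walk u y → Walk u z → y ≡ z
  branch-unique acyclic {u} {y} {z} cy cz py pz with y ≟ z
  ... | yes y≡z = y≡z
  ... | no  y≢z with simplify (reverse py ++ʷ pz)
  ...   | q , unique-q = ⊥-elim (acyclic c (vertices q)
            (2≤length-vertices q y≢z , c∉vertices q ∷ unique-q , closed-linked q cy (E-sym G cz)))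

  reach-split : ∀ r {a b} → T (reach G r a b) →
                Walk a b ⊎ ∃₂ λ r₁ r₂ → r₁ + r₂ ≤ r × T (reach G r₁ a c) × T (reach G r₂ c b)
  reach-split r {a} t with a ≟ c
  ... | yes refl = inj₂ (0 , r , ≤-refl , reach-refl G 0 , t)
  reach-split zero t | no a≢c with reach-zero⁻ G t
  ... | refl = inj₁ (stop a≢c)
  reach-split (suc r) t | no a≢c with reach-suc⁻ G {r} t
  ... | inj₁ p with reach-split r p
  ...   | inj₁ q = inj₁ q
  ...   | inj₂ (r₁ , r₂ , r₁+r₂≤r , p₁ , p₂) =
    inj₂ (r₁ , r₂ , ≤-trans r₁+r₂≤r (n≤1+n r) , p₁ , p₂)
  reach-split (suc r) t | no a≢c | inj₂ (w , e , p) with reach-split r p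
  ...   | inj₁ q = inj₁ (step a≢c e q)
  ...   | inj₂ (r₁ , r₂ , r₁+r₂≤r , p₁ , p₂) =
    inj₂ (suc r₁ , r₂ , s≤s r₁+r₂≤r , reach-step G {r₁} e p₁ , p₂)

  -- distVia u plays the role of d(u, c) + 1, computed by the same bounded search
  -- as dist, so that no appeal to connectivity is needed.
  reachVia : Fin n → ℕ → Bool
  reachVia u zero    = false
  reachVia u (suc r) = reach G r u c

  reach-beyond : ∀ {u x} → E G c x → ¬ Walk u x → ∀ r → reach G r u x ≡ reachVia u r
  reach-beyond {u} {x} cx ¬p r = T-injective (via r) (beyond r)
    where
      via : ∀ r → T (reach G r u x) → T (reachVia u r)
      via r t with reach-split r t
      ... | inj₁ p = ⊥-elim (¬p p)
      ... | inj₂ (r₁ , zero , _ , _ , c≡x) with reach-zero⁻ G c≡x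
      ...   | refl = ⊥-elim (E-irrefl G cx)
      via r t | inj₂ (r₁ , suc r₂ , r₁+1+r₂≤r , p₁ , _) =
        via-shorter (≤-trans (s≤s (m≤m+n r₁ r₂)) (subst (_≤ r) (+-suc r₁ r₂) r₁+1+r₂≤r)) p₁
        where
          via-shorter : ∀ {r₁ r} → suc r₁ ≤ r → T (reach G r₁ u c) → T (reachVia u r)
          via-shorter (s≤s r₁≤r) = reach-mono G r₁≤r
      beyond : ∀ r → T (reachVia u r) → T (reach G r u x)
      beyond (suc r) t = reach-snoc G {r} t cx

  distVia : Fin n → ℕ
  distVia u = search (reachVia u) n 0

  dist-beyond : ∀ {u x} → E G c x → ¬ Walk u x → dist G u x ≡ distVia u
  dist-beyond {u} {x} cx ¬p = trans (distFrom-search n 0) (search-cong (reach-beyond cx ¬p) n 0)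
    where
      distFrom-search : ∀ f r → distFrom G f r u x ≡ search (λ s → reach G s u x) f r
      distFrom-search zero    r = refl
      distFrom-search (suc f) r = cong (if reach G r u x then r else_) (distFrom-search f (suc r))

  neighbours-equidistantButOne : Acyclic G → EquidistantButOne G (E G c) distVia
  neighbours-equidistantButOne acyclic u {y} {z} cy cz y-off z-off =
    decidable-stable (y ≟ z) λ y≢z →
      reachable cy y-off λ py → reachable cz z-off λ pz → y≢z (branch-unique acyclic cy cz py pz)
    where
      reachable : ∀ {x} → E G c x → dist G u x ≢ distVia u → ¬ ¬ Walk u x
      reachable cx x-off ¬p = x-off (dist-beyond cx ¬p)

ceilDiv-≤ : ∀ a k t → a ≤ t * k → ceilDiv a k ≤ t
ceilDiv-≤ a zero    t _ = z≤n
ceilDiv-≤ a (suc k) t a≤t*k = ≤-pred (m<n*o⇒m/o<n {a + k} {suc t} {suc k} a+k<[1+t]*[1+k])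
  where
    open ℕ.≤-Reasoning
    a+k<[1+t]*[1+k] : a + k < suc t * suc k
    a+k<[1+t]*[1+k] = begin-strict
      a + k              <⟨ ≤-reflexive (sym (+-suc a k)) ⟩
      a + suc k          ≤⟨ +-monoˡ-≤ (suc k) a≤t*k ⟩
      t * suc k + suc k  ≡⟨ +-comm (t * suc k) (suc k) ⟩
      suc t * suc k      ∎

foldr-⊔-attained : ∀ {A : Set} (f : A → ℕ) xs → 0 < foldr _⊔_ 0 (map f xs) →
                   ∃ λ x → f x ≡ foldr _⊔_ 0 (map f xs)
foldr-⊔-attained f (x ∷ xs) pos with ⊔-sel (f x) (foldr _⊔_ 0 (map f xs))
... | inj₁ max≡fx = x , sym max≡fx
... | inj₂ max≡rest with foldr-⊔-attained f xs (subst (0 <_) max≡rest pos)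
...   | y , fy≡ = y , trans fy≡ (sym max≡rest)

neighbours : ∀ {n} (G : Graph n) v → ∃ λ S → deg G v ≡ length S × Unique S × All (E G v) S
neighbours {n} G v = filter _ (allFin n) , refl , Unique.filter⁺ _ (Unique.allFin⁺ n) , all-filter _ (allFin n)

mainTheorem14 : ∀ {n : ℕ} (T : Graph n) → IsTree T →
    ∀ (k : ℕ) → ZetaAtMost T k → k < maxDeg T →
    CaptAtLeast T k (ceilDiv (maxDeg T ∸ 1) k)
mainTheorem14 {n} G (_ , acyclic) k _ k<Δ σ t wins
  with foldr-⊔-attained (deg G) (allFin n) (≤-trans (s≤s z≤n) k<Δ)
... | v , deg-v≡Δ with neighbours G v
... | S , deg-v≡|S| , unique-S , S-adjacent = ceilDiv-≤ (maxDeg G ∸ 1) k t Δ-1≤t*k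
  where
    |S|≤t*k+1 : length S ≤ t * k + 1
    |S|≤t*k+1 = StationaryRobbers.capture-bound G σ (Avoiding.neighbours-equidistantButOne G v acyclic)
                  unique-S S-adjacent t wins
    Δ-1≤t*k : maxDeg G ∸ 1 ≤ t * k
    Δ-1≤t*k = begin
      maxDeg G ∸ 1   ≡⟨ cong (_∸ 1) (trans (sym deg-v≡Δ) deg-v≡|S|) ⟩
      length S ∸ 1   ≤⟨ ∸-monoˡ-≤ 1 |S|≤t*k+1 ⟩
      t * k + 1 ∸ 1  ≡⟨ m+n∸n≡m (t * k) 1 ⟩
      t * k          ∎
      where open ℕ.≤-Reasoning
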